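{- Any local incremental topological ordering algorithm must, in the worst case, reorder $\Omega(n\sqrt{m})$ vertices, and hence must take $\Omega(n\sqrt{m})$ time. Precisely: there is an absolute constant $c>0$ such that for all positive integers $n'$, $m'$ with $n'\le m'\le\binom{n'}{2}$ there exist $n,m$ with $n'/c\le n\le cn'$ and $m'/c\le m\le cm'$, and a sequence of $m$ distinct arc additions to an initially arcless graph on $n$ vertices (with a given initial order) that keeps the graph acyclic, such that every local algorithm performs at least $n\sqrt{m}/c$ individual vertex moves on this sequence.
   Context: An incremental topological ordering algorithm maintains an explicit list of the vertices in an order that is topological for the current graph (every arc $(x,y)$ has $x$ before $y$) as arcs are added one at a time, and restores topological order when needed by moving one vertex at a time to a new position in the list. When an arc $(v,w)$ is added with $v$ after $w$ in the current order, the affected vertices are those between $w$ and $v$ inclusive in the current order. The algorithm is local if after each such addition it reorders only affected vertices (the affected vertices occupy the same interval of positions before and after, permuted so that the order becomes topological). Each vertex move costs at least unit time. The paper assumes $m=\Omega(n)$ arcs are added. -}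

module Defs where

open import Data.Nat using (ℕ; suc; _<_)
open import Data.Fin using (Fin; toℕ)
open import Data.Product using (Σ; ∃; _×_; _,_)
open import Data.List using (List; []; _∷_; _++_)
open import Data.List.Membership.Propositional using (_∈_)
open import Data.List.Relation.Binary.Permutation.Propositional using (_↭_)
open import Data.Vec using (Vec; lookup)
open import Relation.Binary.PropositionalEquality using (_≡_)
open import Relation.Binary.Construct.Closure.Transitive using (TransClosure)
open import Relation.Nullary using (¬_)

Arc : ℕ → Set
Arc n = Fin n × Fin n

Edge : ∀ {n m} → Vec (Arc n) m → ℕ → Fin n → Fin n → Set
Edge {m = m} arcs k x y = Σ (Fin m) λ j → (toℕ j < k) × (lookup arcs j ≡ (x , y))

Acyclic : ∀ {n} → (Fin n → Fin n → Set) → Set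
Acyclic {n} E = (v : Fin n) → ¬ TransClosure E v v

Before : ∀ {n} → Fin n → Fin n → List (Fin n) → Set
Before x y o = ∃ λ as → ∃ λ bs → (o ≡ as ++ x ∷ bs) × (y ∈ bs)

Topological : ∀ {n} → (Fin n → Fin n → Set) → List (Fin n) → Set
Topological {n} E o = (x y : Fin n) → E x y → Before x y o

-- Local reordering after adding arc (v , w): if v is after w in o, the
-- affected interval (from w to v inclusive) is permuted in place and all other
-- positions are unchanged; otherwise nothing is affected and o is unchanged.
LocalStep : ∀ {n} → Arc n → List (Fin n) → List (Fin n) → Set
LocalStep (v , w) o o' =
  (Before w v o →
     ∃ λ as → ∃ λ mid → ∃ λ bs → ∃ λ mid' →
       (o ≡ as ++ (w ∷ mid ++ v ∷ []) ++ bs) ×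
       (o' ≡ as ++ mid' ++ bs) ×
       (mid' ↭ (w ∷ mid ++ v ∷ [])))
  × (¬ Before w v o → o' ≡ o)

-- A single vertex move: remove a vertex from the list and reinsert it
-- at some position.
data Move {A : Set} : List A → List A → Set where
  move : ∀ as bs cs ds x → as ++ bs ≡ cs ++ ds →
         Move (as ++ x ∷ bs) (cs ++ x ∷ ds)

data MovesIn {A : Set} : ℕ → List A → List A → Set where
  done : ∀ {o} → MovesIn 0 o o
  step : ∀ {k o o' o''} → Move o o' → MovesIn k o' o'' → MovesIn (suc k) o o''

module Submission where

-- Take k blocks L₀ … L_κ of r vertices on a left side
-- and k blocks R₀ … R_κ of r vertices on a right side, n = 2 k r vertices in all, in the
-- initial order L₀ … L_κ R₀ … R_κ.  First add the arcs of the chain through L and of the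
-- chain through R; they agree with the initial order, so nothing moves.  Then, for
-- j = 0, …, κ and i = κ, …, 0, add an arc from the last vertex of Rⱼ to the first
-- vertex of Lᵢ.  Just before it, Lᵢ and Rⱼ are adjacent (Lᵢ first), and all other
-- blocks are placed so that a local algorithm keeping the chains in order has no
-- choice: it must swap the two blocks, which costs at least r moves.  So the k² arcs
-- of the second phase force k² r moves, while m ≈ 2 k r + k²; with k ≈ √m and
-- r ≈ n / √m this is Ω(n √m), and a potential shows all graphs stay acyclic.

open import Defs
open import Data.Nat using (ℕ; zero; suc; _+_; _*_; _∸_; _^_; _≤_; _<_; z≤n; s≤s; s≤s⁻¹)
open import Data.Nat.Properties
open import Data.Nat.Combinatorics using (_C_; nCk+nC[k+1]≡[n+1]C[k+1]; nC1≡n)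
open import Data.Nat.DivMod using (_mod_; _/_; m<n⇒m%n≡m; m%n<n; m≡m%n+[m/n]*n; m/n*n≤m; m≥n⇒m/n>0)
open import Data.Nat.Tactic.RingSolver using (solve-∀)
open import Data.Fin using (Fin; zero; suc; toℕ; fromℕ<; inject₁; _↑ʳ_)
import Data.Fin.Properties as Fin
open import Data.Vec using (Vec; lookup; tabulate; sum)
import Data.Vec.Properties as Vec
open import Data.Product using (Σ; ∃; _×_; _,_; proj₁; proj₂)
open import Data.Sum using (inj₁; inj₂)
open import Data.Empty using (⊥; ⊥-elim)
open import Data.List using (List; []; _∷_; _++_; length; allFin)
import Data.List as List
open import Data.List.Properties using (++-assoc; ++-identityʳ; length-++; ∷-injective)
open import Data.List.Membership.Propositional using (_∈_; _∉_; find; lose)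
open import Data.List.Membership.Propositional.Properties using (∈-++⁺ˡ; ∈-++⁺ʳ; ∈-∃++)
open import Data.List.Membership.DecPropositional using (_∈?_)
open import Data.List.Relation.Unary.Any using (here; there; any?)
import Data.List.Relation.Unary.All.Properties as All
open import Data.List.Relation.Unary.AllPairs using ([]; _∷_)
open import Data.List.Relation.Unary.Linked using (Linked; []; [-]; _∷_)
import Data.List.Relation.Unary.Linked as Linked
open import Data.List.Relation.Unary.Unique.Propositional using (Unique)
open import Data.List.Relation.Unary.Unique.Propositional.Properties using (Unique[x∷xs]⇒x∉xs; allFin⁺)
open import Data.List.Relation.Binary.Permutation.Propositional using (_↭_; ↭-sym; ↭-trans; ↭-reflexive; ↭⇒↭ₛ)
open import Data.List.Relation.Binary.Permutation.Propositional.Properties using (∈-resp-↭; drop-∷; zoom; ++-comm; ++⁺ˡ; shifts)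
open import Data.List.Relation.Binary.Permutation.Setoid.Properties using (Unique-resp-↭)
open import Function using (_∘_)
open import Function.Definitions using (Injective)
open import Relation.Binary.Construct.Closure.Transitive using (TransClosure; [_]; _∷_)
open import Relation.Binary.Definitions using (DecidableEquality)
open import Relation.Binary.PropositionalEquality
open import Relation.Binary.PropositionalEquality.Properties using (setoid)
open import Relation.Nullary using (¬_; Dec; yes; no; ¬?)
open import Relation.Nullary.Decidable using (decidable-stable)

private
  variable
    A : Set
    a b v w x y : A
    l o o' P Q X Y : List A

Unique-++ʳ : ∀ (X : List A) → Unique (X ++ l) → Unique l
Unique-++ʳ []      u       = u
Unique-++ʳ (_ ∷ X) (_ ∷ u) = Unique-++ʳ X u

Unique-++ˡ : ∀ (l : List A) → Unique (l ++ Y) → Unique l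
Unique-++ˡ []      _       = []
Unique-++ˡ (_ ∷ l) (h ∷ u) = All.++⁻ˡ l h ∷ Unique-++ˡ l u

Unique-↭ : l ↭ o → Unique l → Unique o
Unique-↭ σ = Unique-resp-↭ (setoid _) (↭⇒↭ₛ σ)

unique-split : ∀ (X P X' P' : List A) → Unique (X ++ w ∷ P) →
               X ++ w ∷ P ≡ X' ++ w ∷ P' → X ≡ X' × P ≡ P'
unique-split []      P []       P' u refl = refl , refl
unique-split []      P (_ ∷ X') P' u refl = ⊥-elim (Unique[x∷xs]⇒x∉xs u (∈-++⁺ʳ X' (here refl)))
unique-split (_ ∷ X) P []       P' u refl = ⊥-elim (Unique[x∷xs]⇒x∉xs u (∈-++⁺ʳ X (here refl)))
unique-split (_ ∷ X) P (_ ∷ X') P' (_ ∷ u) eq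
  with refl , eq′ ← ∷-injective eq
  with refl , refl ← unique-split X P X' P' u eq′ = refl , refl

data Precedes (x y : A) : List A → Set where
  here  : y ∈ l → Precedes x y (x ∷ l)
  there : Precedes x y l → Precedes x y (a ∷ l)

precedes-split : ∀ (X Y : List A) → y ∈ Y → Precedes x y (X ++ x ∷ Y)
precedes-split []      Y y∈Y = here y∈Y
precedes-split (_ ∷ X) Y y∈Y = there (precedes-split X Y y∈Y)

Before⇒Precedes : ∀ {n} {x y : Fin n} {o} → Before x y o → Precedes x y o
Before⇒Precedes (X , Y , refl , y∈Y) = precedes-split X Y y∈Y

precedes-∈ʳ : Precedes x y l → y ∈ l
precedes-∈ʳ (here y∈l) = there y∈l
precedes-∈ʳ (there p)  = there (precedes-∈ʳ p)

precedes-++ : ∀ (P Q : List A) → x ∈ P → y ∈ Q → Precedes x y (P ++ Q)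
precedes-++ (_ ∷ P) Q (here refl) y∈Q = here (∈-++⁺ʳ P y∈Q)
precedes-++ (_ ∷ P) Q (there x∈P) y∈Q = there (precedes-++ P Q x∈P y∈Q)

precedes-prefix : ∀ (X : List A) → Precedes x y l → Precedes x y (X ++ l)
precedes-prefix []      p = p
precedes-prefix (_ ∷ X) p = there (precedes-prefix X p)

precedes-asym : Unique l → Precedes x y l → Precedes y x l → ⊥
precedes-asym u       (here y∈l) (here x∈l) = Unique[x∷xs]⇒x∉xs u y∈l
precedes-asym u       (here y∈l) (there q)  = Unique[x∷xs]⇒x∉xs u (precedes-∈ʳ q)
precedes-asym u       (there p)  (here x∈l) = Unique[x∷xs]⇒x∉xs u (precedes-∈ʳ p)
precedes-asym (_ ∷ u) (there p)  (there q)  = precedes-asym u p q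

precedes-restrict : ∀ (X l Y : List A) → Unique (X ++ l ++ Y) → x ∈ l → y ∈ l →
                    Precedes x y (X ++ l ++ Y) → Precedes x y l
precedes-restrict X l Y u x∈l y∈l p =
  drop-suffix l (Unique-++ʳ X u) y∈l (drop-prefix X u (∈-++⁺ˡ x∈l) p)
  where
  drop-prefix : ∀ X {m} → Unique (X ++ m) → x ∈ m → Precedes x y (X ++ m) → Precedes x y m
  drop-prefix []      _       _   p         = p
  drop-prefix (_ ∷ X) u       x∈m (here _)  = ⊥-elim (Unique[x∷xs]⇒x∉xs u (∈-++⁺ʳ X x∈m))
  drop-prefix (_ ∷ X) (_ ∷ u) x∈m (there p) = drop-prefix X u x∈m p
  drop-suffix : ∀ l → Unique (l ++ Y) → y ∈ l → Precedes x y (l ++ Y) → Precedes x y l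
  drop-suffix (_ ∷ l) u       (here refl) (here y∈)  = ⊥-elim (Unique[x∷xs]⇒x∉xs u y∈)
  drop-suffix (_ ∷ l) u       (there y∈l) (here _)   = here y∈l
  drop-suffix (_ ∷ l) u       (here refl) (there p)  = ⊥-elim (Unique[x∷xs]⇒x∉xs u (precedes-∈ʳ p))
  drop-suffix (_ ∷ l) (_ ∷ u) (there y∈l) (there p)  = there (drop-suffix l u y∈l p)

∈-delete : ∀ (X : List A) → ¬ a ≡ x → a ∈ X ++ x ∷ Y → a ∈ X ++ Y
∈-delete []      a≢x (here a≡x) = ⊥-elim (a≢x a≡x)
∈-delete []      _   (there p)  = p
∈-delete (_ ∷ X) _   (here eq)  = here eq
∈-delete (_ ∷ X) a≢x (there p)  = there (∈-delete X a≢x p)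

∈-insert : ∀ (X : List A) → a ∈ X ++ Y → a ∈ X ++ x ∷ Y
∈-insert []      p          = there p
∈-insert (_ ∷ X) (here eq)  = here eq
∈-insert (_ ∷ X) (there p)  = there (∈-insert X p)

precedes-delete : ∀ (X : List A) → ¬ a ≡ x → ¬ b ≡ x →
                  Precedes a b (X ++ x ∷ Y) → Precedes a b (X ++ Y)
precedes-delete []      a≢x _   (here _)  = ⊥-elim (a≢x refl)
precedes-delete []      _   _   (there p) = p
precedes-delete (_ ∷ X) _   b≢x (here p)  = here (∈-delete X b≢x p)
precedes-delete (_ ∷ X) a≢x b≢x (there p) = there (precedes-delete X a≢x b≢x p)

precedes-insert : ∀ (X : List A) → Precedes a b (X ++ Y) → Precedes a b (X ++ x ∷ Y)
precedes-insert []      p         = there p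
precedes-insert (_ ∷ X) (here p)  = here (∈-insert X p)
precedes-insert (_ ∷ X) (there p) = there (precedes-insert X p)

OrderKeptOutside : List A → List A → List A → Set
OrderKeptOutside ms o o' = ∀ {a b} → a ∉ ms → b ∉ ms → Precedes a b o → Precedes a b o'

moved-entries : ∀ {q} → MovesIn q o o' → Σ (List A) λ ms → length ms ≡ q × OrderKeptOutside ms o o'
moved-entries done = [] , refl , λ _ _ p → p
moved-entries (step (move X Y X' Y' x eq) rest) with moved-entries rest
... | ms , len , kept = x ∷ ms , cong suc len , λ a∉ b∉ p →
  kept (a∉ ∘ there) (b∉ ∘ there)
       (precedes-insert X' (subst (Precedes _ _) eq
         (precedes-delete X (a∉ ∘ here) (b∉ ∘ here) p)))

unique-⊆⇒length-≤ : ∀ (P ms : List A) → Unique P → (∀ {z} → z ∈ P → z ∈ ms) → length P ≤ length ms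
unique-⊆⇒length-≤ []      ms _       _   = z≤n
unique-⊆⇒length-≤ (x ∷ P) ms (h ∷ u) P⊆ms with ∈-∃++ (P⊆ms (here refl))
... | X , Y , refl = begin
  suc (length P)            ≤⟨ s≤s (unique-⊆⇒length-≤ P (X ++ Y) u P⊆XY) ⟩
  suc (length (X ++ Y))     ≡⟨ cong suc (length-++ X) ⟩
  suc (length X + length Y) ≡⟨ +-suc (length X) (length Y) ⟨
  length X + length (x ∷ Y) ≡⟨ length-++ X ⟨
  length (X ++ x ∷ Y)       ∎
  where
  open ≤-Reasoning
  P⊆XY : ∀ {z} → z ∈ P → z ∈ X ++ Y
  P⊆XY z∈P = ∈-delete X (λ { refl → Unique[x∷xs]⇒x∉xs (h ∷ u) z∈P }) (P⊆ms (there z∈P))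

module _ {A : Set} (_≟_ : DecidableEquality A) where

  ∃-∉ : ∀ (P ms : List A) → Unique P → length ms < length P → ∃ λ a → a ∈ P × a ∉ ms
  ∃-∉ P ms u ms<P with any? (λ a → ¬? (_∈?_ _≟_ a ms)) P
  ... | yes outside = find outside
  ... | no  none    = ⊥-elim (<⇒≱ ms<P (unique-⊆⇒length-≤ P ms u P⊆ms))
    where
    P⊆ms : ∀ {z} → z ∈ P → z ∈ ms
    P⊆ms {z} z∈P = decidable-stable (_∈?_ _≟_ z ms) (λ z∉ms → none (lose z∈P z∉ms))

  -- Swapping two adjacent segments P and Q of a duplicate-free list takes at least
  -- min |P| |Q| moves: with fewer moves some a ∈ P and some b ∈ Q are never moved,
  -- yet their relative order gets reversed.
  swap-cost : ∀ {r q} X P Q Y → Unique (X ++ Q ++ P ++ Y) → r ≤ length P → r ≤ length Q →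
              MovesIn q (X ++ P ++ Q ++ Y) (X ++ Q ++ P ++ Y) → r ≤ q
  swap-cost {r} {q} X P Q Y u r≤P r≤Q moves with r ≤? q
  ... | yes r≤q = r≤q
  ... | no  r≰q = ⊥-elim (precedes-asym u (kept a∉ms b∉ms a-before-b) b-before-a)
    where
    uQPY = Unique-++ʳ X u
    uP   = Unique-++ˡ P (Unique-++ʳ Q uQPY)
    uQ   = Unique-++ˡ Q uQPY
    ms-kept = moved-entries moves
    ms   = proj₁ ms-kept
    kept = proj₂ (proj₂ ms-kept)
    ms<r : length ms < r
    ms<r = subst (_< r) (sym (proj₁ (proj₂ ms-kept))) (≰⇒> r≰q)
    a-fresh = ∃-∉ P ms uP (<-≤-trans ms<r r≤P)
    b-fresh = ∃-∉ Q ms uQ (<-≤-trans ms<r r≤Q)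
    a∈P = proj₁ (proj₂ a-fresh)
    b∈Q = proj₁ (proj₂ b-fresh)
    a∉ms = proj₂ (proj₂ a-fresh)
    b∉ms = proj₂ (proj₂ b-fresh)
    a-before-b = precedes-prefix X (precedes-++ P (Q ++ Y) a∈P (∈-++⁺ˡ b∈Q))
    b-before-a = precedes-prefix X (precedes-++ Q (P ++ Y) b∈Q (∈-++⁺ˡ a∈P))

chain-predecessor : ∀ {E : A → A → Set} {c} → Linked E (x ∷ c) → y ∈ c →
                    ∃ λ p → p ∈ x ∷ c × E p y
chain-predecessor (e ∷ _)     (here refl) = _ , here refl , e
chain-predecessor (_ ∷ chain) (there y∈c) with chain-predecessor chain y∈c
... | p , p∈c , e = p , there p∈c , e

chain-forced : ∀ {E : A → A → Set} (ℓ c : List A) → Unique ℓ → ℓ ↭ c → Linked E c →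
               (∀ {a b} → E a b → a ∈ c → b ∈ c → Precedes a b ℓ) → ℓ ≡ c
chain-forced []      []      _ _ _ _ = refl
chain-forced []      (_ ∷ _) _ σ _ _ with ∈-resp-↭ (↭-sym σ) (here refl)
... | ()
chain-forced (_ ∷ _) []      _ σ _ _ with ∈-resp-↭ σ (here refl)
... | ()
chain-forced {E = E} (y ∷ ℓ) (x ∷ c) u σ chain respects with ∈-resp-↭ σ (here refl)
... | there y∈c = ⊥-elim (Unique[x∷xs]⇒x∉xs u (y-reoccurs (respects e p∈c (there y∈c))))
  where
  -- y heads ℓ but has a chain predecessor p, which ℓ must place before y.
  pred = chain-predecessor chain y∈c
  p∈c  = proj₁ (proj₂ pred)
  e    = proj₂ (proj₂ pred)
  y-reoccurs : ∀ {p} → Precedes p y (y ∷ ℓ) → y ∈ ℓ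
  y-reoccurs (here y∈ℓ) = y∈ℓ
  y-reoccurs (there p)  = precedes-∈ʳ p
... | here refl = cong (y ∷_) (chain-forced ℓ c (Unique-++ʳ (y ∷ []) u) (drop-∷ σ) (Linked.tail chain) respects′)
  where
  respects′ : ∀ {a b} → E a b → a ∈ c → b ∈ c → Precedes a b ℓ
  respects′ e a∈c b∈c with respects e (there a∈c) (there b∈c)
  ... | here _  = ⊥-elim (Unique[x∷xs]⇒x∉xs u (∈-resp-↭ (↭-sym (drop-∷ σ)) a∈c))
  ... | there p = p

local-step-forward : ∀ {n} {v w : Fin n} {o o'} → Unique o → Precedes v w o →
                     LocalStep (v , w) o o' → o' ≡ o
local-step-forward u v-before-w (_ , unaffected) =
  unaffected (λ w-before-v → precedes-asym u v-before-w (Before⇒Precedes w-before-v))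

local-step-interval : ∀ {n} {v w : Fin n} X M Y {o'} → Unique (X ++ w ∷ M ++ v ∷ Y) →
  LocalStep (v , w) (X ++ w ∷ M ++ v ∷ Y) o' →
  ∃ λ mid' → (o' ≡ X ++ mid' ++ Y) × (mid' ↭ w ∷ M ++ v ∷ [])
local-step-interval {v = v} {w} X M Y u (affected , _)
  with X' , M' , Y' , mid' , o≡ , o'≡ , σ ← affected (X , M ++ v ∷ Y , refl , ∈-++⁺ʳ M (here refl))
  with refl , M-rest ← unique-split X (M ++ v ∷ Y) X' (M' ++ v ∷ Y') u
                         (trans o≡ (cong (λ z → X' ++ w ∷ z) (++-assoc M' (v ∷ []) Y')))
  with refl , refl ← unique-split M Y M' Y' (Unique-++ʳ (X ++ w ∷ []) (subst Unique (sym (++-assoc X (w ∷ []) _)) u)) M-rest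
  = mid' , o'≡ , σ

interval-view : ∀ X P' Q' Y → X ++ (w ∷ P') ++ (Q' ++ v ∷ []) ++ Y ≡ X ++ w ∷ (P' ++ Q') ++ v ∷ Y
interval-view {v = v} X P' Q' Y = cong (λ z → X ++ _ ∷ z)
  (trans (cong (P' ++_) (++-assoc Q' (v ∷ []) Y)) (sym (++-assoc P' Q' (v ∷ Y))))

swap-forced : ∀ {n} {v w : Fin n} {E : Fin n → Fin n → Set} X P' Q' Y {o'} →
  Unique (X ++ (w ∷ P') ++ (Q' ++ v ∷ []) ++ Y) → Linked E ((Q' ++ v ∷ []) ++ w ∷ P') →
  LocalStep (v , w) (X ++ (w ∷ P') ++ (Q' ++ v ∷ []) ++ Y) o' → Topological E o' →
  o' ≡ X ++ (Q' ++ v ∷ []) ++ (w ∷ P') ++ Y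
swap-forced {v = v} {w} {E} X P' Q' Y u chain local topological
  with mid' , refl , σ ← local-step-interval X (P' ++ Q') Y (subst Unique (interval-view X P' Q' Y) u)
                            (subst (λ o → LocalStep (v , w) o _) (interval-view X P' Q' Y) local)
  = cong (X ++_) (trans (cong (_++ Y) mid'≡QP) (++-assoc Qv Pw Y))
  where
  Pw : List (Fin _)
  Pw = w ∷ P'
  Qv : List (Fin _)
  Qv = Q' ++ v ∷ []
  σ-QP : mid' ↭ Qv ++ Pw
  σ-QP = ↭-trans σ (↭-trans (↭-reflexive (cong (w ∷_) (++-assoc P' Q' (v ∷ [])))) (++-comm Pw Qv))
  u-after : Unique (X ++ mid' ++ Y)
  u-after = Unique-↭ (zoom X (↭-sym (↭-trans σ-QP (++-comm Qv Pw))))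
              (subst Unique (cong (X ++_) (sym (++-assoc Pw Qv Y))) u)
  respects : ∀ {a b} → E a b → a ∈ Qv ++ Pw → b ∈ Qv ++ Pw → Precedes a b mid'
  respects e a∈ b∈ = precedes-restrict X mid' Y u-after
    (∈-resp-↭ (↭-sym σ-QP) a∈) (∈-resp-↭ (↭-sym σ-QP) b∈) (Before⇒Precedes (topological _ _ e))
  mid'≡QP : mid' ≡ Qv ++ Pw
  mid'≡QP = chain-forced mid' (Qv ++ Pw) (Unique-++ˡ mid' (Unique-++ʳ X u-after)) σ-QP chain respects

chain-join : ∀ {E : A → A → Set} (l : List A) {m} → Linked E (l ++ x ∷ []) → E x y →
             Linked E (y ∷ m) → Linked E ((l ++ x ∷ []) ++ y ∷ m)
chain-join []          [-]        e chain = e ∷ chain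
chain-join (_ ∷ [])    (e′ ∷ _)   e chain = e′ ∷ e ∷ chain
chain-join (_ ∷ _ ∷ l) (e′ ∷ rest) e chain = e′ ∷ chain-join (_ ∷ l) rest e chain

sequence-induction : ∀ {L : Set} {m} (os : Fin (suc m) → L) (Inv : ℕ → L → Set) →
  Inv 0 (os zero) →
  (∀ (i : Fin m) → Inv (toℕ i) (os (inject₁ i)) → Inv (suc (toℕ i)) (os (suc i))) →
  ∀ (i : Fin (suc m)) → Inv (toℕ i) (os i)
sequence-induction          os Inv base advance zero    = base
sequence-induction {m = suc m} os Inv base advance (suc i) =
  sequence-induction (os ∘ suc) (Inv ∘ suc) (advance zero base) (λ i → advance (suc i)) i

sum-drop : ∀ c {d} (f : Fin (c + d) → ℕ) → sum (tabulate (f ∘ (c ↑ʳ_))) ≤ sum (tabulate f)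
sum-drop zero    f = ≤-refl
sum-drop (suc c) f = ≤-trans (sum-drop c (f ∘ suc)) (m≤n+m _ (f zero))

sum-≥ : ∀ {r} d (f : Fin d → ℕ) → (∀ i → r ≤ f i) → d * r ≤ sum (tabulate f)
sum-≥ zero    f _     = z≤n
sum-≥ (suc d) f r≤f = +-mono-≤ (r≤f zero) (sum-≥ d (f ∘ suc) (r≤f ∘ suc))

^2≡* : ∀ x → x ^ 2 ≡ x * x
^2≡* x = cong (x *_) (*-identityʳ x)

x+x≤8x : ∀ x → x + x ≤ 8 * x
x+x≤8x x = ≤-trans (≤-reflexive (double x)) (*-monoˡ-≤ x {2} {8} (m≤m+n 2 6))
  where
  double : ∀ x → x + x ≡ 2 * x
  double = solve-∀

x+x+x≤8x : ∀ x → x + x + x ≤ 8 * x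
x+x+x≤8x x = ≤-trans (≤-reflexive (triple x)) (*-monoˡ-≤ x {3} {8} (m≤m+n 3 5))
  where
  triple : ∀ x → x + x + x ≡ 3 * x
  triple = solve-∀

next-square≤4square : ∀ κ → suc (suc κ) * suc (suc κ) ≤ 4 * (suc κ * suc κ)
next-square≤4square κ = ≤-trans (m≤m+n _ (3 * κ * κ + 4 * κ)) (≤-reflexive (expand κ))
  where
  expand : ∀ κ → suc (suc κ) * suc (suc κ) + (3 * κ * κ + 4 * κ) ≡ 4 * (suc κ * suc κ)
  expand = solve-∀

size-bound : ∀ k r m S → m ≤ (k * r + k * r) + k * k → r ≤ 4 * k → k * k * r ≤ S →
             (k * r + k * r) ^ 2 * m ≤ (8 * S) ^ 2
size-bound k r m S m≤ r≤4k k²r≤S = begin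
  (k * r + k * r) ^ 2 * m                      ≡⟨ cong (_* m) (^2≡* (k * r + k * r)) ⟩
  n * n * m                                    ≤⟨ *-monoʳ-≤ (n * n) m≤ ⟩
  n * n * (n + k * k)                          ≡⟨ factor k r ⟩
  n * n * (k * (2 * r + k))                    ≤⟨ *-monoʳ-≤ (n * n) (*-monoʳ-≤ k 2r+k≤16k) ⟩
  n * n * (k * (16 * k))                       ≡⟨ collect k r ⟩
  (8 * (k * k * r)) * (8 * (k * k * r))        ≤⟨ *-mono-≤ 8k²r≤8S 8k²r≤8S ⟩
  (8 * S) * (8 * S)                            ≡⟨ ^2≡* (8 * S) ⟨
  (8 * S) ^ 2                                  ∎
  where
  open ≤-Reasoning
  n : ℕ
  n = k * r + k * r
  factor : ∀ k r → (k * r + k * r) * (k * r + k * r) * ((k * r + k * r) + k * k) ≡ (k * r + k * r) * (k * r + k * r) * (k * (2 * r + k))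
  factor = solve-∀
  collect : ∀ k r → (k * r + k * r) * (k * r + k * r) * (k * (16 * k)) ≡ (8 * (k * k * r)) * (8 * (k * k * r))
  collect = solve-∀
  nine : ∀ k → 8 * k + k ≡ 9 * k
  nine = solve-∀
  2r+k≤16k : 2 * r + k ≤ 16 * k
  2r+k≤16k = begin
    2 * r + k       ≤⟨ +-monoˡ-≤ k (*-monoʳ-≤ 2 r≤4k) ⟩
    2 * (4 * k) + k ≡⟨ cong (_+ k) (*-assoc 2 4 k) ⟨
    8 * k + k       ≡⟨ nine k ⟩
    9 * k           ≤⟨ *-monoˡ-≤ k {9} {16} (m≤m+n 9 7) ⟩
    16 * k          ∎
  8k²r≤8S : 8 * (k * k * r) ≤ 8 * S
  8k²r≤8S = *-monoʳ-≤ 8 k²r≤S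

module Construction (κ r' : ℕ) where

  k r half n : ℕ
  k    = suc κ
  r    = suc r'
  half = k * r
  n    = half + half

  -- Vertices 0 … half-1 form the left side L, vertices half … n-1 the right side R.
  vertex : ℕ → Fin n
  vertex a = a mod n

  toℕ-vertex : ∀ {a} → a < n → toℕ (vertex a) ≡ a
  toℕ-vertex {a} a<n = trans (Fin.toℕ-fromℕ< _) (m<n⇒m%n≡m a<n)

  run : ℕ → ℕ → List (Fin n)
  run a zero    = []
  run a (suc l) = vertex a ∷ run (suc a) l

  length-run : ∀ a l → length (run a l) ≡ l
  length-run a zero    = refl
  length-run a (suc l) = cong suc (length-run (suc a) l)

  run-++ : ∀ a l l' → run a (l + l') ≡ run a l ++ run (a + l) l'
  run-++ a zero    l' = cong (λ b → run b l') (sym (+-identityʳ a))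
  run-++ a (suc l) l' = cong (vertex a ∷_)
    (trans (run-++ (suc a) l l') (cong (λ b → run (suc a) l ++ run b l') (sym (+-suc a l))))

  run-merge : ∀ a b l l' L → b ≡ a + l → L ≡ l + l' → run a l ++ run b l' ≡ run a L
  run-merge a _ l l' _ refl refl = sym (run-++ a l l')

  run-snoc : ∀ a l → run a (suc l) ≡ run a l ++ vertex (a + l) ∷ []
  run-snoc a l = trans (cong (run a) (+-comm 1 l)) (run-++ a l 1)

  run-∈ : ∀ a l b → a ≤ b → b < a + l → vertex b ∈ run a l
  run-∈ a zero    b a≤b b<a = ⊥-elim (<-irrefl refl (<-≤-trans b<a (subst (_≤ b) (sym (+-identityʳ a)) a≤b)))
  run-∈ a (suc l) b a≤b b<  with m≤n⇒m<n∨m≡n a≤b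
  ... | inj₂ refl = here refl
  ... | inj₁ a<b  = there (run-∈ (suc a) l b a<b (subst (b <_) (+-suc a l) b<))

  run-precedes : ∀ a l b → a ≤ b → suc b < a + l → Precedes (vertex b) (vertex (suc b)) (run a l)
  run-precedes a zero    b a≤b b< = ⊥-elim (<-irrefl refl (<-≤-trans (<-trans (n<1+n b) b<) (subst (_≤ b) (sym (+-identityʳ a)) a≤b)))
  run-precedes a (suc l) b a≤b b< with m≤n⇒m<n∨m≡n a≤b
  ... | inj₂ refl = here (run-∈ (suc a) l (suc a) ≤-refl (subst (suc a <_) (+-suc a l) b<))
  ... | inj₁ a<b  = there (run-precedes (suc a) l b a<b (subst (suc b <_) (+-suc a l) b<))

  run-chain : ∀ {E : Fin n → Fin n → Set} a l →
              (∀ b → a ≤ b → suc b < a + l → E (vertex b) (vertex (suc b))) → Linked E (run a l)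
  run-chain a zero          _    = []
  run-chain a (suc zero)    _    = [-]
  run-chain a (suc (suc l)) link =
    link a ≤-refl (subst (_< a + suc (suc l)) (+-comm a 1) (+-monoʳ-< a (s≤s (s≤s z≤n)))) ∷
    run-chain (suc a) (suc l) λ b a<b b< → link b (<⇒≤ a<b) (subst (suc b <_) (sym (+-suc a (suc l))) b<)

  run-all : run 0 n ≡ allFin n
  run-all = tabulated 0 n (λ i → i) (λ _ → refl) ≤-refl
    where
    tabulated : ∀ a l (f : Fin l → Fin n) → (∀ i → toℕ (f i) ≡ a + toℕ i) → a + l ≤ n →
                run a l ≡ List.tabulate f
    tabulated a zero    f _   _  = refl
    tabulated a (suc l) f f≡ a+l≤n = cong₂ _∷_
      (Fin.toℕ-injective (trans (toℕ-vertex (<-≤-trans (m<m+n a (s≤s z≤n)) a+l≤n)) (sym (trans (f≡ zero) (+-identityʳ a)))))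
      (tabulated (suc a) l (f ∘ suc) (λ i → trans (f≡ (suc i)) (+-suc a (toℕ i))) (subst (_≤ n) (+-suc a l) a+l≤n))

  left-block right-block : ℕ → List (Fin n)
  left-block  i = run (i * r) r
  right-block j = run (half + j * r) r

  -- At stage (j , i) the next arc goes from the last
  -- vertex of Rⱼ to the first vertex of Lᵢ; i runs down from κ to 0 for each
  -- j = 0, …, κ in turn.
  record Stage : Set where
    constructor stage-at
    field
      j jr i ir : ℕ
      j+jr≡κ : j + jr ≡ κ
      i+ir≡κ : i + ir ≡ κ

  module _ (s : Stage) where
    open Stage s

    -- The order at stage (j , i) is  R₀ … R_{j-1} L₀ … L_{i-1} | Lᵢ Rⱼ | L_{i+1} … L_κ R_{j+1} … R_κ.
    prefix suffix configuration swapped : List (Fin n)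
    prefix        = run half (j * r) ++ run 0 (i * r)
    suffix        = run (suc i * r) (ir * r) ++ run (half + suc j * r) (jr * r)
    configuration = prefix ++ left-block i ++ right-block j ++ suffix
    swapped       = prefix ++ right-block j ++ left-block i ++ suffix

    source target : ℕ
    source = half + j * r + r'
    target = i * r

    index : ℕ
    index = j * k + ir

  Final : Stage → Set
  Final s = Stage.i s ≡ 0 × Stage.jr s ≡ 0

  next : Stage → Stage
  next (stage-at j jr (suc i) ir j+jr i+ir) = stage-at j jr i (suc ir) j+jr (trans (+-suc i ir) i+ir)
  next (stage-at j (suc jr) zero ir j+jr _) = stage-at (suc j) jr κ 0 (trans (sym (+-suc j jr)) j+jr) (+-identityʳ κ)
  next s@(stage-at j zero zero ir _ _)      = s

  stage : ℕ → Stage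
  stage zero    = stage-at 0 κ κ 0 refl (+-identityʳ κ)
  stage (suc u) = next (stage u)

  index-next : ∀ s → ¬ Final s → index (next s) ≡ suc (index s)
  index-next (stage-at j jr (suc i) ir _ _) _ = +-suc (j * k) ir
  index-next (stage-at j (suc jr) zero ir _ refl) _ = next-block j κ
    where
    next-block : ∀ j κ → suc j * suc κ + 0 ≡ suc (j * suc κ + κ)
    next-block = solve-∀
  index-next (stage-at j zero zero ir _ _) not-final = ⊥-elim (not-final (refl , refl))

  index-final : ∀ s → Final s → suc (index s) ≡ k * k
  index-final (stage-at j .0 .0 ir j+0≡κ refl) (refl , refl)
    with refl ← trans (sym (+-identityʳ j)) j+0≡κ = last-stage κ
    where
    last-stage : ∀ κ → suc (κ * suc κ + κ) ≡ suc κ * suc κ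
    last-stage = solve-∀

  index-stage : ∀ u → u < k * k → index (stage u) ≡ u
  stage-not-final : ∀ u → suc u < k * k → ¬ Final (stage u)

  index-stage zero    _  = refl
  index-stage (suc u) su< =
    trans (index-next (stage u) (stage-not-final u su<)) (cong suc (index-stage u (<-trans (n<1+n u) su<)))

  stage-not-final u su< final =
    <-irrefl (trans (cong suc (sym (index-stage u (<-trans (n<1+n u) su<)))) (index-final (stage u) final)) su<

  block-step : ∀ i r → suc i * r ≡ i * r + r
  block-step = solve-∀

  shifted-block-step : ∀ a i r → a + suc i * r ≡ (a + i * r) + r
  shifted-block-step = solve-∀

  swapped-next : ∀ s → ¬ Final s → swapped s ≡ configuration (next s)
  swapped-next (stage-at j jr (suc i) ir _ _) _ = begin
      (Rs ++ Ls) ++ Rⱼ ++ Lᵢ ++ Lt ++ Rt           ≡⟨ ++-assoc Rs Ls _ ⟩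
      Rs ++ Ls ++ Rⱼ ++ Lᵢ ++ Lt ++ Rt             ≡⟨ cong (λ z → Rs ++ z ++ Rⱼ ++ Lᵢ ++ Lt ++ Rt) Ls-split ⟩
      Rs ++ (Ls′ ++ Lᵢ₋₁) ++ Rⱼ ++ Lᵢ ++ Lt ++ Rt  ≡⟨ cong (Rs ++_) (++-assoc Ls′ Lᵢ₋₁ _) ⟩
      Rs ++ Ls′ ++ Lᵢ₋₁ ++ Rⱼ ++ Lᵢ ++ Lt ++ Rt    ≡⟨ cong (λ z → Rs ++ Ls′ ++ Lᵢ₋₁ ++ Rⱼ ++ z) (trans (sym (++-assoc Lᵢ Lt Rt)) (cong (_++ Rt) Lt-merge)) ⟩
      Rs ++ Ls′ ++ Lᵢ₋₁ ++ Rⱼ ++ Lt′ ++ Rt         ≡⟨ ++-assoc Rs Ls′ _ ⟨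
      (Rs ++ Ls′) ++ Lᵢ₋₁ ++ Rⱼ ++ Lt′ ++ Rt       ∎
    where
    open ≡-Reasoning
    Rs Ls Ls′ Lᵢ Lᵢ₋₁ Rⱼ Lt Lt′ Rt : List (Fin n)
    Rs    = run half (j * r)
    Ls    = run 0 (suc i * r)
    Ls′   = run 0 (i * r)
    Lᵢ    = left-block (suc i)
    Lᵢ₋₁  = left-block i
    Rⱼ    = right-block j
    Lt    = run (suc (suc i) * r) (ir * r)
    Lt′   = run (suc i * r) (suc ir * r)
    Rt    = run (half + suc j * r) (jr * r)
    Ls-split : Ls ≡ Ls′ ++ Lᵢ₋₁
    Ls-split = sym (run-merge 0 (i * r) (i * r) r (suc i * r) refl (block-step i r))
    Lt-merge : Lᵢ ++ Lt ≡ Lt′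
    Lt-merge = run-merge (suc i * r) (suc (suc i) * r) r (ir * r) (suc ir * r) (block-step (suc i) r) refl
  swapped-next (stage-at j (suc jr) zero ir _ refl) _ = begin
      (Rs ++ []) ++ Rⱼ ++ L₀ ++ Lt ++ Rt        ≡⟨ cong (_++ Rⱼ ++ L₀ ++ Lt ++ Rt) (++-identityʳ Rs) ⟩
      Rs ++ Rⱼ ++ L₀ ++ Lt ++ Rt                ≡⟨ ++-assoc Rs Rⱼ _ ⟨
      (Rs ++ Rⱼ) ++ L₀ ++ Lt ++ Rt              ≡⟨ cong (_++ L₀ ++ Lt ++ Rt) Rs-merge ⟩
      Rs′ ++ L₀ ++ Lt ++ Rt                     ≡⟨ cong (Rs′ ++_) (++-assoc L₀ Lt Rt) ⟨
      Rs′ ++ (L₀ ++ Lt) ++ Rt                   ≡⟨ cong₂ (λ x y → Rs′ ++ x ++ y) L-regroup Rt-split ⟩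
      Rs′ ++ (Ls ++ L_κ) ++ Rⱼ₊₁ ++ Rt′         ≡⟨ cong (Rs′ ++_) (++-assoc Ls L_κ _) ⟩
      Rs′ ++ Ls ++ L_κ ++ Rⱼ₊₁ ++ Rt′           ≡⟨ ++-assoc Rs′ Ls _ ⟨
      (Rs′ ++ Ls) ++ L_κ ++ Rⱼ₊₁ ++ Rt′         ∎
    where
    open ≡-Reasoning
    Rs Rs′ Rⱼ Rⱼ₊₁ L₀ Lt Ls L_κ Rt Rt′ : List (Fin n)
    Rs   = run half (j * r)
    Rs′  = run half (suc j * r)
    Rⱼ   = right-block j
    Rⱼ₊₁ = right-block (suc j)
    L₀   = left-block 0
    Lt   = run (1 * r) (κ * r)
    Ls   = run 0 (κ * r)
    L_κ  = left-block κ
    Rt   = run (half + suc j * r) (suc jr * r)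
    Rt′  = run (half + suc (suc j) * r) (jr * r)
    Rs-merge : Rs ++ Rⱼ ≡ Rs′
    Rs-merge = run-merge half (half + j * r) (j * r) r (suc j * r) refl (block-step j r)
    L-regroup : L₀ ++ Lt ≡ Ls ++ L_κ
    L-regroup = trans (run-merge 0 (1 * r) r (κ * r) half (+-identityʳ r) refl)
                      (sym (run-merge 0 (κ * r) (κ * r) r half refl (block-step κ r)))
    Rt-split : Rt ≡ Rⱼ₊₁ ++ Rt′
    Rt-split = sym (run-merge (half + suc j * r) (half + suc (suc j) * r) r (jr * r) (suc jr * r)
                              (shifted-block-step half (suc j) r) refl)
  swapped-next (stage-at j zero zero ir _ _) not-final = ⊥-elim (not-final (refl , refl))

  configuration-initial : configuration (stage 0) ≡ run 0 n
  configuration-initial = begin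
      Ls ++ L_κ ++ R₀ ++ Rt            ≡⟨ ++-assoc Ls L_κ _ ⟨
      (Ls ++ L_κ) ++ R₀ ++ Rt          ≡⟨ cong₂ _++_ (run-merge 0 (κ * r) (κ * r) r half refl (block-step κ r)) R-merge ⟩
      run 0 half ++ run half half      ≡⟨ run-merge 0 half half half n refl refl ⟩
      run 0 n                          ∎
    where
    open ≡-Reasoning
    Ls L_κ R₀ Rt : List (Fin n)
    Ls  = run 0 (κ * r)
    L_κ = left-block κ
    R₀  = right-block 0
    Rt  = run (half + 1 * r) (κ * r)
    R-merge : R₀ ++ Rt ≡ run half half
    R-merge = trans (run-merge (half + 0) (half + 1 * r) r (κ * r) half (shifted-block-step half 0 r) refl)
                    (cong (λ a → run a half) (+-identityʳ half))

  -- First chain-length arcs form the chain 0 → 1 → ⋯ → half-1 through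
  -- L, the next chain-length arcs the chain half → ⋯ → n-1 through R; then one arc per
  -- stage, k * k in all.  (Note half ≡ suc chain-length.)
  chain-length chain-arcs m : ℕ
  chain-length = r' + κ * r
  chain-arcs   = chain-length + chain-length
  m            = chain-arcs + k * k

  ends-by-phase : ∀ t → Dec (t < chain-length) → Dec (t < chain-arcs) → ℕ × ℕ
  ends-by-phase t (yes _) _       = t , suc t
  ends-by-phase t (no _)  (yes _) = suc t , suc (suc t)
  ends-by-phase t (no _)  (no _)  = source (stage (t ∸ chain-arcs)) , target (stage (t ∸ chain-arcs))

  ends : ℕ → ℕ × ℕ
  ends t = ends-by-phase t (t <? chain-length) (t <? chain-arcs)

  data ArcKind (t : ℕ) : Set where
    left-chain  : t < chain-length → ends t ≡ (t , suc t) → ArcKind t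
    right-chain : chain-length ≤ t → t < chain-arcs → ends t ≡ (suc t , suc (suc t)) → ArcKind t
    stage-arc   : chain-arcs ≤ t →
                  ends t ≡ (source (stage (t ∸ chain-arcs)) , target (stage (t ∸ chain-arcs))) → ArcKind t

  arc-kind : ∀ t → ArcKind t
  arc-kind t = classify (t <? chain-length) (t <? chain-arcs) refl
    where
    classify : ∀ d d' → ends t ≡ ends-by-phase t d d' → ArcKind t
    classify (yes p) _       e = left-chain p e
    classify (no p)  (yes q) e = right-chain (≮⇒≥ p) q e
    classify (no _)  (no q)  e = stage-arc (≮⇒≥ q) e

  arc : ℕ → Arc n
  arc t = vertex (proj₁ (ends t)) , vertex (proj₂ (ends t))

  arcs : Vec (Arc n) m
  arcs = tabulate (arc ∘ toℕ)

  lookup-arcs : ∀ (i : Fin m) → lookup arcs i ≡ arc (toℕ i)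
  lookup-arcs = Vec.lookup∘tabulate (arc ∘ toℕ)

  arc-≡ : ∀ {t a b} → ends t ≡ (a , b) → arc t ≡ (vertex a , vertex b)
  arc-≡ = cong (λ (a , b) → vertex a , vertex b)

  arc-edge : ∀ t {K a b} → t < m → t < K → ends t ≡ (a , b) → Edge arcs K (vertex a) (vertex b)
  arc-edge t t<m t<K e = fromℕ< t<m , subst (_< _) (sym (Fin.toℕ-fromℕ< t<m)) t<K ,
    trans (lookup-arcs (fromℕ< t<m)) (trans (cong arc (Fin.toℕ-fromℕ< t<m)) (arc-≡ e))

  block-fits : ∀ x → x ≤ κ → x * r + r ≤ half
  block-fits x x≤κ = ≤-trans (+-monoˡ-≤ r (*-monoˡ-≤ r x≤κ)) (≤-reflexive (sym (block-step κ r)))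

  i≤κ : ∀ s → Stage.i s ≤ κ
  i≤κ s = subst (Stage.i s ≤_) (Stage.i+ir≡κ s) (m≤m+n _ _)
  j≤κ : ∀ s → Stage.j s ≤ κ
  j≤κ s = subst (Stage.j s ≤_) (Stage.j+jr≡κ s) (m≤m+n _ _)

  right-block-fits : ∀ s → half + Stage.j s * r + r ≤ n
  right-block-fits s = subst (_≤ n) (sym (+-assoc half (Stage.j s * r) r)) (+-monoʳ-≤ half (block-fits (Stage.j s) (j≤κ s)))

  half≤n : half ≤ n
  half≤n = m≤m+n half half

  target-< : ∀ s → target s < half
  target-< s = <-≤-trans (m<m+n (Stage.i s * r) (s≤s z≤n))
                 (block-fits (Stage.i s) (i≤κ s))

  half≤source : ∀ s → half ≤ source s
  half≤source s = ≤-trans (m≤m+n half (Stage.j s * r)) (m≤m+n _ r')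

  source-< : ∀ s → source s < n
  source-< s = <-≤-trans (+-monoʳ-< (half + Stage.j s * r) (n<1+n r')) (right-block-fits s)

  n≡2+chain-arcs : n ≡ suc (suc chain-arcs)
  n≡2+chain-arcs = cong suc (+-suc chain-length chain-length)

  ends-< : ∀ t → proj₁ (ends t) < n × proj₂ (ends t) < n
  ends-< t with arc-kind t
  ... | left-chain t< e rewrite e = <-trans t< (<-≤-trans (n<1+n chain-length) half≤n) , ≤-trans (s≤s t<) half≤n
  ... | right-chain _ t< e rewrite e = <-trans (n<1+n _) t+2<n , t+2<n
    where
    t+2<n : suc (suc t) < n
    t+2<n = subst (suc (suc (suc t)) ≤_) (sym n≡2+chain-arcs) (s≤s (s≤s t<))
  ... | stage-arc _ e rewrite e = source-< (stage (t ∸ chain-arcs)) , <-≤-trans (target-< (stage (t ∸ chain-arcs))) half≤n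

  -- A potential that every arc increases: L is shifted after R.
  potential-by-side : ∀ a → Dec (a < half) → ℕ
  potential-by-side a (yes _) = a + half
  potential-by-side a (no _)  = a ∸ half

  potential : ℕ → ℕ
  potential a = potential-by-side a (a <? half)

  potential-L : ∀ {a} → a < half → potential a ≡ a + half
  potential-L {a} a<half with a <? half
  ... | yes _ = refl
  ... | no a≮ = ⊥-elim (a≮ a<half)

  potential-R : ∀ {a} → half ≤ a → potential a ≡ a ∸ half
  potential-R {a} half≤a with a <? half
  ... | yes a< = ⊥-elim (<⇒≱ a< half≤a)
  ... | no _   = refl

  ends-increase : ∀ t → potential (proj₁ (ends t)) < potential (proj₂ (ends t))
  ends-increase t with arc-kind t
  ... | left-chain t< e rewrite e =
    subst₂ _<_ (sym (potential-L (<-trans t< (n<1+n _)))) (sym (potential-L (s≤s t<))) (+-monoˡ-< half (n<1+n t))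
  ... | right-chain cl≤t _ e rewrite e =
    subst₂ _<_ (sym (potential-R (s≤s cl≤t))) (sym (potential-R (≤-trans (s≤s cl≤t) (n≤1+n _))))
      (subst (suc t ∸ half <_) (sym (+-∸-assoc 1 (s≤s cl≤t))) (n<1+n _))
  ... | stage-arc _ e rewrite e =
    subst₂ _<_ (sym (potential-R (half≤source s))) (sym (potential-L (target-< s)))
      (<-≤-trans source-half<half (m≤n+m half (target s)))
    where
    s : Stage
    s = stage (t ∸ chain-arcs)
    source-half<half : source s ∸ half < half
    source-half<half = +-cancelˡ-< half _ _ (subst (_< n) (sym (m+[n∸m]≡n (half≤source s))) (source-< s))

  arcs-acyclic : ∀ K → Acyclic (Edge arcs K)
  arcs-acyclic K x cycle = <-irrefl refl (closure-increases cycle)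
    where
    vertex-potential : Fin n → ℕ
    vertex-potential x = potential (toℕ x)
    edge-increases : ∀ {x y} → Edge arcs K x y → vertex-potential x < vertex-potential y
    edge-increases (i , _ , e) with refl ← trans (sym (lookup-arcs i)) e =
      subst₂ (λ a b → potential a < potential b)
        (sym (toℕ-vertex (proj₁ (ends-< (toℕ i))))) (sym (toℕ-vertex (proj₂ (ends-< (toℕ i)))))
        (ends-increase (toℕ i))
    closure-increases : ∀ {x y} → TransClosure (Edge arcs K) x y → vertex-potential x < vertex-potential y
    closure-increases [ e ]      = edge-increases e
    closure-increases (e ∷ rest) = <-trans (edge-increases e) (closure-increases rest)

  -- Distinct stages have distinct arcs: the source determines j and the target i.
  stage-injective : ∀ u u' → u < k * k → u' < k * k →
    source (stage u) ≡ source (stage u') → target (stage u) ≡ target (stage u') → u ≡ u'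
  stage-injective u u' u< u'< same-source same-target =
    trans (sym (index-stage u u<)) (trans (cong₂ (λ a b → a * k + b) same-j same-ir) (index-stage u' u'<))
    where
    s s' : Stage
    s  = stage u
    s' = stage u'
    same-j : Stage.j s ≡ Stage.j s'
    same-j = *-cancelʳ-≡ _ _ r (+-cancelˡ-≡ half _ _ (+-cancelʳ-≡ r' _ _ same-source))
    same-i : Stage.i s ≡ Stage.i s'
    same-i = *-cancelʳ-≡ _ _ r same-target
    same-ir : Stage.ir s ≡ Stage.ir s'
    same-ir = +-cancelˡ-≡ (Stage.i s) _ _
      (trans (Stage.i+ir≡κ s) (trans (sym (Stage.i+ir≡κ s')) (cong (_+ Stage.ir s') (sym same-i))))

  sides-differ : ∀ {a b} → a < half → half ≤ b → a ≡ b → ⊥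
  sides-differ a<half half≤b refl = <⇒≱ a<half half≤b

  ends-injective : ∀ t t' → t < m → t' < m → ends t ≡ ends t' → t ≡ t'
  ends-injective t t' t<m t'<m same with arc-kind t | arc-kind t'
  ... | left-chain _ e | left-chain _ e'
    with refl ← trans (sym e) (trans same e') = refl
  ... | right-chain _ _ e | right-chain _ _ e'
    with refl ← trans (sym e) (trans same e') = refl
  ... | left-chain t< e | right-chain cl≤t' _ e' =
    ⊥-elim (sides-differ (<-trans t< (n<1+n _)) (s≤s cl≤t') (cong proj₁ (trans (sym e) (trans same e'))))
  ... | right-chain cl≤t _ e | left-chain t'< e' =
    ⊥-elim (sides-differ (<-trans t'< (n<1+n _)) (s≤s cl≤t) (cong proj₁ (trans (sym e') (trans (sym same) e))))
  ... | left-chain t< e | stage-arc _ e' =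
    ⊥-elim (sides-differ (<-trans t< (n<1+n _)) (half≤source (stage (t' ∸ chain-arcs))) (cong proj₁ (trans (sym e) (trans same e'))))
  ... | stage-arc _ e | left-chain t'< e' =
    ⊥-elim (sides-differ (<-trans t'< (n<1+n _)) (half≤source (stage (t ∸ chain-arcs))) (cong proj₁ (trans (sym e') (trans (sym same) e))))
  ... | right-chain cl≤t _ e | stage-arc _ e' =
    ⊥-elim (sides-differ (target-< (stage (t' ∸ chain-arcs))) (≤-trans (s≤s cl≤t) (n≤1+n _)) (cong proj₂ (trans (sym e') (trans (sym same) e))))
  ... | stage-arc _ e | right-chain cl≤t' _ e' =
    ⊥-elim (sides-differ (target-< (stage (t ∸ chain-arcs))) (≤-trans (s≤s cl≤t') (n≤1+n _)) (cong proj₂ (trans (sym e) (trans same e'))))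
  ... | stage-arc ca≤t e | stage-arc ca≤t' e' =
    trans (sym (m+[n∸m]≡n ca≤t)) (trans (cong (chain-arcs +_) same-stage) (m+[n∸m]≡n ca≤t'))
    where
    same-ends : (source (stage (t ∸ chain-arcs)) , target (stage (t ∸ chain-arcs)))
              ≡ (source (stage (t' ∸ chain-arcs)) , target (stage (t' ∸ chain-arcs)))
    same-ends = trans (sym e) (trans same e')
    same-stage : t ∸ chain-arcs ≡ t' ∸ chain-arcs
    same-stage = stage-injective (t ∸ chain-arcs) (t' ∸ chain-arcs) (m<n+o⇒m∸n<o t chain-arcs t<m) (m<n+o⇒m∸n<o t' chain-arcs t'<m)
                   (cong proj₁ same-ends) (cong proj₂ same-ends)

  arcs-injective : Injective _≡_ _≡_ (lookup arcs)
  arcs-injective {i} {i'} same = Fin.toℕ-injective (ends-injective (toℕ i) (toℕ i') (Fin.toℕ<n i) (Fin.toℕ<n i')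
    (cong₂ _,_ (vertex-injective (proj₁ (ends-< (toℕ i))) (proj₁ (ends-< (toℕ i'))) (cong proj₁ same-arc))
               (vertex-injective (proj₂ (ends-< (toℕ i))) (proj₂ (ends-< (toℕ i'))) (cong proj₂ same-arc))))
    where
    same-arc : arc (toℕ i) ≡ arc (toℕ i')
    same-arc = trans (sym (lookup-arcs i)) (trans same (lookup-arcs i'))
    vertex-injective : ∀ {a b} → a < n → b < n → vertex a ≡ vertex b → a ≡ b
    vertex-injective a<n b<n eq = trans (sym (toℕ-vertex a<n)) (trans (cong toℕ eq) (toℕ-vertex b<n))

  ends-left : ∀ t → t < chain-length → ends t ≡ (t , suc t)
  ends-left t t< with arc-kind t
  ... | left-chain _ e      = e
  ... | right-chain cl≤t _ _ = ⊥-elim (<⇒≱ t< cl≤t)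
  ... | stage-arc ca≤t _    = ⊥-elim (<⇒≱ (<-≤-trans t< (m≤m+n _ _)) ca≤t)

  ends-right : ∀ t → chain-length ≤ t → t < chain-arcs → ends t ≡ (suc t , suc (suc t))
  ends-right t cl≤t t< with arc-kind t
  ... | left-chain t<cl _ = ⊥-elim (<⇒≱ t<cl cl≤t)
  ... | right-chain _ _ e = e
  ... | stage-arc ca≤t _  = ⊥-elim (<⇒≱ t< ca≤t)

  ends-stage : ∀ t → chain-arcs ≤ t →
               ends t ≡ (source (stage (t ∸ chain-arcs)) , target (stage (t ∸ chain-arcs)))
  ends-stage t ca≤t with arc-kind t
  ... | left-chain t<cl _   = ⊥-elim (<⇒≱ (<-≤-trans t<cl (m≤m+n _ _)) ca≤t)
  ... | right-chain _ t< _  = ⊥-elim (<⇒≱ t< ca≤t)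
  ... | stage-arc _ e       = e

  L-chain : ∀ K → chain-arcs ≤ K → ∀ a l → a + l ≤ half → Linked (Edge arcs K) (run a l)
  L-chain K ca≤K a l a+l≤half = run-chain a l λ b _ b< → link b (s≤s⁻¹ (<-≤-trans b< a+l≤half))
    where
    link : ∀ b → b < chain-length → Edge arcs K (vertex b) (vertex (suc b))
    link b b<cl = arc-edge b (<-≤-trans b<ca (m≤m+n _ _)) (<-≤-trans b<ca ca≤K) (ends-left b b<cl)
      where b<ca = <-≤-trans b<cl (m≤m+n chain-length chain-length)

  R-chain : ∀ K → chain-arcs ≤ K → ∀ a l → half ≤ a → a + l ≤ n → Linked (Edge arcs K) (run a l)
  R-chain K ca≤K a l half≤a a+l≤n = run-chain a l λ b a≤b b< → link b (≤-trans half≤a a≤b) (<-≤-trans b< a+l≤n)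
    where
    link : ∀ b → half ≤ b → suc b < n → Edge arcs K (vertex b) (vertex (suc b))
    link (suc b) (s≤s cl≤b) b< = arc-edge b (<-≤-trans b<ca (m≤m+n _ _)) (<-≤-trans b<ca ca≤K) (ends-right b cl≤b b<ca)
      where b<ca = s≤s⁻¹ (s≤s⁻¹ (subst (suc (suc b) <_) n≡2+chain-arcs b<))

  -- The order that any local algorithm is forced to hold before the t-th arc.
  order : ℕ → List (Fin n)
  order t = configuration (stage (t ∸ chain-arcs))

  order-first-phase : ∀ t → t ≤ chain-arcs → order t ≡ run 0 n
  order-first-phase t t≤ca = trans (cong (configuration ∘ stage) (m≤n⇒m∸n≡0 t≤ca)) configuration-initial

  swapped-↭ : ∀ s → swapped s ↭ configuration s
  swapped-↭ s = ++⁺ˡ (prefix s) (shifts (right-block (Stage.j s)) (left-block (Stage.i s)))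

  configuration-↭ : ∀ u → u < k * k → configuration (stage u) ↭ allFin n
  configuration-↭ zero    _   = ↭-reflexive (trans configuration-initial run-all)
  configuration-↭ (suc u) su< = ↭-trans (↭-reflexive (sym (swapped-next (stage u) (stage-not-final u su<))))
    (↭-trans (swapped-↭ (stage u)) (configuration-↭ u (<-trans (n<1+n u) su<)))

  order-unique : ∀ t → t < m → Unique (order t)
  order-unique t t<m = Unique-↭ (↭-sym (configuration-↭ _ (m<n+o⇒m∸n<o t chain-arcs t<m))) (allFin⁺ n)

  -- An arc of the first phase is already forward in the order 0, …, n-1: nothing moves.
  first-phase-step : ∀ t → t < chain-arcs → ∀ {o'} → LocalStep (arc t) (order t) o' → o' ≡ order (suc t)
  first-phase-step t t<ca {o'} local =
    trans (local-step-forward (order-unique t (<-≤-trans t<ca (m≤m+n _ _))) forward local)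
          (trans (order-first-phase t (<⇒≤ t<ca)) (sym (order-first-phase (suc t) t<ca)))
    where
    forward : Precedes (proj₁ (arc t)) (proj₂ (arc t)) (order t)
    forward = subst (Precedes _ _) (sym (order-first-phase t (<⇒≤ t<ca))) (forward-initially (t <? chain-length))
      where
      along : ∀ {a} → ends t ≡ (a , suc a) → suc a < n → Precedes (proj₁ (arc t)) (proj₂ (arc t)) (run 0 n)
      along {a} e a+1<n = subst (λ (x , y) → Precedes x y (run 0 n)) (sym (arc-≡ e)) (run-precedes 0 n a z≤n a+1<n)
      forward-initially : Dec (t < chain-length) → Precedes (proj₁ (arc t)) (proj₂ (arc t)) (run 0 n)
      forward-initially (yes t<cl) = along (ends-left t t<cl) (≤-trans (s≤s t<cl) half≤n)
      forward-initially (no t≮cl)  = along (ends-right t (≮⇒≥ t≮cl) t<ca) (subst (suc (suc t) <_) (sym n≡2+chain-arcs) (s≤s (s≤s t<ca)))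

  -- A second-phase arc goes from the last vertex of Rⱼ to the first vertex of Lᵢ, joining
  -- the chains Rⱼ and Lᵢ into one; this forces the two adjacent blocks to be swapped.
  stage-step : ∀ t → chain-arcs ≤ t → t < m → ∀ {o'} → LocalStep (arc t) (order t) o' →
               Topological (Edge arcs (suc t)) o' → o' ≡ swapped (stage (t ∸ chain-arcs))
  stage-step t ca≤t t<m {o'} local topological =
    subst (λ R → o' ≡ prefix s ++ R ++ left-block i ++ suffix s) (sym Rⱼ-snoc)
      (swap-forced (prefix s) (run (suc (i * r)) r') (run start r') (suffix s) unique′ chain local′ topological)
    where
    s : Stage
    s = stage (t ∸ chain-arcs)
    i j start : ℕ
    i = Stage.i s
    j = Stage.j s
    start = half + j * r
    E : Fin n → Fin n → Set
    E = Edge arcs (suc t)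
    Rⱼ-snoc : right-block j ≡ run start r' ++ vertex (source s) ∷ []
    Rⱼ-snoc = run-snoc start r'
    as-segments : order t ≡ prefix s ++ left-block i ++ (run start r' ++ vertex (source s) ∷ []) ++ suffix s
    as-segments = cong (λ R → prefix s ++ left-block i ++ R ++ suffix s) Rⱼ-snoc
    unique′ : Unique (prefix s ++ left-block i ++ (run start r' ++ vertex (source s) ∷ []) ++ suffix s)
    unique′ = subst Unique as-segments (order-unique t t<m)
    local′ : LocalStep (vertex (source s) , vertex (target s))
               (prefix s ++ left-block i ++ (run start r' ++ vertex (source s) ∷ []) ++ suffix s) o'
    local′ = subst₂ (λ x o → LocalStep x o o') (arc-≡ (ends-stage t ca≤t)) as-segments local
    ca≤1+t : chain-arcs ≤ suc t
    ca≤1+t = ≤-trans ca≤t (n≤1+n t)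
    chain : Linked E ((run start r' ++ vertex (source s) ∷ []) ++ left-block i)
    chain = chain-join (run start r')
      (subst (Linked E) Rⱼ-snoc (R-chain (suc t) ca≤1+t start r (m≤m+n half _) (right-block-fits s)))
      (arc-edge t t<m (n<1+n t) (ends-stage t ca≤t))
      (L-chain (suc t) ca≤1+t (i * r) r (block-fits i (i≤κ s)))

  stage-cost : ∀ t → chain-arcs ≤ t → t < m → ∀ {q} →
               MovesIn q (order t) (swapped (stage (t ∸ chain-arcs))) → r ≤ q
  stage-cost t ca≤t t<m moves =
    swap-cost Fin._≟_ (prefix s) (left-block (Stage.i s)) (right-block (Stage.j s)) (suffix s)
      (Unique-↭ (↭-sym (swapped-↭ s)) (order-unique t t<m))
      (≤-reflexive (sym (length-run _ r))) (≤-reflexive (sym (length-run _ r))) moves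
    where
    s : Stage
    s = stage (t ∸ chain-arcs)

  swapped-order : ∀ t → chain-arcs ≤ t → suc t < m → swapped (stage (t ∸ chain-arcs)) ≡ order (suc t)
  swapped-order t ca≤t 1+t<m =
    trans (swapped-next (stage u) (stage-not-final u 1+u<)) (cong (configuration ∘ stage) (sym 1+t∸ca))
    where
    u : ℕ
    u = t ∸ chain-arcs
    1+t∸ca : suc t ∸ chain-arcs ≡ suc u
    1+t∸ca = +-∸-assoc 1 ca≤t
    1+u< : suc u < k * k
    1+u< = subst (_< k * k) 1+t∸ca (m<n+o⇒m∸n<o (suc t) chain-arcs 1+t<m)

  module _ (os : Fin (suc m) → List (Fin n)) (starts : os zero ≡ run 0 n)
           (local : ∀ i → LocalStep (lookup arcs i) (os (inject₁ i)) (os (suc i)))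
           (topological : ∀ i → Topological (Edge arcs (suc (toℕ i))) (os (suc i))) where

    Follows : ℕ → List (Fin n) → Set
    Follows t o = t < m → o ≡ order t

    local-at : ∀ i → os (inject₁ i) ≡ order (toℕ i) → LocalStep (arc (toℕ i)) (order (toℕ i)) (os (suc i))
    local-at i same = subst₂ (λ x o → LocalStep x o (os (suc i))) (lookup-arcs i) same (local i)

    follows-order : ∀ (i : Fin (suc m)) → Follows (toℕ i) (os i)
    follows-order = sequence-induction os Follows (λ _ → trans starts (sym (order-first-phase 0 z≤n))) advance
      where
      advance : ∀ i → Follows (toℕ i) (os (inject₁ i)) → Follows (suc (toℕ i)) (os (suc i))
      advance i follows 1+t<m with toℕ i <? chain-arcs
      ... | yes t<ca = first-phase-step (toℕ i) t<ca (local-at i (follows (Fin.toℕ<n i)))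
      ... | no t≮ca  = trans (stage-step (toℕ i) (≮⇒≥ t≮ca) (Fin.toℕ<n i) (local-at i (follows (Fin.toℕ<n i))) (topological i))
                             (swapped-order (toℕ i) (≮⇒≥ t≮ca) 1+t<m)

    moves-≥ : (ks : Fin m → ℕ) → (∀ i → MovesIn (ks i) (os (inject₁ i)) (os (suc i))) →
              k * k * r ≤ sum (tabulate ks)
    moves-≥ ks moves = ≤-trans (sum-≥ (k * k) (ks ∘ (chain-arcs ↑ʳ_)) (λ i → stage-move (chain-arcs ↑ʳ i) (ca≤ i)))
                                 (sum-drop chain-arcs ks)
      where
      ca≤ : ∀ i → chain-arcs ≤ toℕ (chain-arcs ↑ʳ i)
      ca≤ i = subst (chain-arcs ≤_) (sym (Fin.toℕ-↑ʳ chain-arcs i)) (m≤m+n _ _)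
      stage-move : ∀ i → chain-arcs ≤ toℕ i → r ≤ ks i
      stage-move i ca≤t = stage-cost (toℕ i) ca≤t (Fin.toℕ<n i)
        (subst₂ (MovesIn (ks i)) before after (moves i))
        where
        before : os (inject₁ i) ≡ order (toℕ i)
        before = trans (follows-order (inject₁ i) (subst (_< m) (sym (Fin.toℕ-inject₁ i)) (Fin.toℕ<n i)))
                       (cong order (Fin.toℕ-inject₁ i))
        after : os (suc i) ≡ swapped (stage (toℕ i ∸ chain-arcs))
        after = stage-step (toℕ i) ca≤t (Fin.toℕ<n i) (local-at i before) (topological i)

  module Sizes {n′ m′ : ℕ} (k²≤m′ : k * k ≤ m′) (m′<[k+1]² : m′ < suc k * suc k)
               (rk≤n′ : r * k ≤ n′) (n′<[r+1]k : n′ < suc r * k) (n′≤m′ : n′ ≤ m′) where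

    half≤n′ : half ≤ n′
    half≤n′ = subst (_≤ n′) (*-comm r k) rk≤n′

    m′≤4k² : m′ ≤ 4 * (k * k)
    m′≤4k² = ≤-trans (<⇒≤ m′<[k+1]²) (next-square≤4square κ)

    n′≤8n : n′ ≤ 8 * n
    n′≤8n = begin
      n′            ≤⟨ <⇒≤ n′<[r+1]k ⟩
      k + r * k     ≤⟨ +-monoˡ-≤ (r * k) (m≤n*m k r) ⟩
      r * k + r * k ≡⟨ cong₂ _+_ (*-comm r k) (*-comm r k) ⟩
      n             ≤⟨ m≤n*m n 8 ⟩
      8 * n         ∎
      where open ≤-Reasoning

    n≤8n′ : n ≤ 8 * n′
    n≤8n′ = ≤-trans (+-mono-≤ half≤n′ half≤n′) (x+x≤8x n′)

    m′≤8m : m′ ≤ 8 * m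
    m′≤8m = ≤-trans m′≤4k² (*-mono-≤ {4} {8} (m≤m+n 4 4) (m≤n+m (k * k) chain-arcs))

    m≤8m′ : m ≤ 8 * m′
    m≤8m′ = ≤-trans (+-mono-≤ (+-mono-≤ cl≤m′ cl≤m′) k²≤m′) (x+x+x≤8x m′)
      where
      cl≤m′ : chain-length ≤ m′
      cl≤m′ = ≤-trans (n≤1+n chain-length) (≤-trans half≤n′ n′≤m′)

    r≤4k : r ≤ 4 * k
    r≤4k = <⇒≤ (*-cancelʳ-< k r (4 * k)
      (<-≤-trans (≤-<-trans (≤-trans rk≤n′ n′≤m′) m′<[k+1]²)
                 (≤-trans (next-square≤4square κ) (≤-reflexive (sym (*-assoc 4 k k))))))

    instance-bound : ∀ S → k * k * r ≤ S → n ^ 2 * m ≤ (8 * S) ^ 2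
    instance-bound S = size-bound k r m S (+-monoˡ-≤ (k * k) (+-mono-≤ (n≤1+n _) (n≤1+n _))) r≤4k

HardInstance : ℕ → ℕ → ℕ → Set
HardInstance c n′ m′ =
  Σ ℕ λ n → Σ ℕ λ m →
    (n′ ≤ c * n) × (n ≤ c * n′) × (m′ ≤ c * m) × (m ≤ c * m′) ×
    Σ (Vec (Arc n) m) λ arcs →
    Σ (List (Fin n)) λ o₀ →
      (o₀ ↭ allFin n) ×
      Injective _≡_ _≡_ (lookup arcs) ×
      ((k : ℕ) → k ≤ m → Acyclic (Edge arcs k)) ×
      ((os : Fin (suc m) → List (Fin n)) →
       os zero ≡ o₀ →
       ((i : Fin m) → LocalStep (lookup arcs i) (os (inject₁ i)) (os (suc i))) →
       ((i : Fin m) → Topological (Edge arcs (suc (toℕ i))) (os (suc i))) →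
       (ks : Fin m → ℕ) →
       ((i : Fin m) → MovesIn (ks i) (os (inject₁ i)) (os (suc i))) →
       n ^ 2 * m ≤ (c * sum (tabulate ks)) ^ 2)

construction-is-hard : ∀ κ r' {n′ m′} →
  suc κ * suc κ ≤ m′ → m′ < suc (suc κ) * suc (suc κ) →
  suc r' * suc κ ≤ n′ → n′ < suc (suc r') * suc κ → n′ ≤ m′ → HardInstance 8 n′ m′
construction-is-hard κ r' k²≤m′ m′< rk≤n′ n′< n′≤m′ =
  n , m , n′≤8n , n≤8n′ , m′≤8m , m≤8m′ , arcs , run 0 n ,
  ↭-reflexive run-all , arcs-injective , (λ K _ → arcs-acyclic K) ,
  λ os starts local topological ks moves →
    instance-bound (sum (tabulate ks)) (moves-≥ os starts local topological ks moves)
  where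
  open Construction κ r'
  open Sizes k²≤m′ m′< rk≤n′ n′< n′≤m′

integer-sqrt : ∀ m → 1 ≤ m → Σ ℕ λ κ → suc κ * suc κ ≤ m × m < suc (suc κ) * suc (suc κ)
integer-sqrt (suc zero)    _ = 0 , s≤s z≤n , s≤s (s≤s z≤n)
integer-sqrt (suc (suc m)) _ with integer-sqrt (suc m) (s≤s z≤n)
... | κ , lo , hi with suc (suc m) <? suc (suc κ) * suc (suc κ)
...   | yes below = κ , m≤n⇒m≤1+n lo , below
...   | no  above = suc κ , ≮⇒≥ above , ≤-trans (s≤s hi) (square-gap (suc κ))
  where
  square-gap : ∀ a → suc (suc a * suc a) ≤ suc (suc a) * suc (suc a)
  square-gap a = ≤-trans (s≤s (m≤m+n (suc a * suc a) (a + a + 2))) (≤-reflexive (expand a))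
    where
    expand : ∀ a → suc (suc a * suc a + (a + a + 2)) ≡ suc (suc a) * suc (suc a)
    expand = solve-∀

C2≤square : ∀ n → n C 2 ≤ n * n
C2≤square zero    = z≤n
C2≤square (suc n) = begin
  suc n C 2         ≡⟨ nCk+nC[k+1]≡[n+1]C[k+1] n 1 ⟨
  n C 1 + n C 2     ≡⟨ cong (_+ n C 2) (nC1≡n n) ⟩
  n + n C 2         ≤⟨ +-monoʳ-≤ n (C2≤square n) ⟩
  n + n * n         ≤⟨ m≤m+n (n + n * n) (suc n) ⟩
  n + n * n + suc n ≡⟨ expand n ⟩
  suc n * suc n     ∎
  where
  open ≤-Reasoning
  expand : ∀ n → n + n * n + suc n ≡ suc n * suc n
  expand = solve-∀

-- Choose k = ⌊√m′⌋ and r = ⌊n′ / k⌋; then k ≤ n′ (as k² ≤ m′ ≤ n′²), so r ≥ 1.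
hard-instance : ∀ n′ m′ → 1 ≤ n′ → n′ ≤ m′ → m′ ≤ n′ C 2 → HardInstance 8 n′ m′
hard-instance n′ m′ 1≤n′ n′≤m′ m′≤C2 with integer-sqrt m′ (≤-trans 1≤n′ n′≤m′)
... | κ , k²≤m′ , m′< = choose-r (n′ / suc κ) refl
  where
  k≤n′ : suc κ ≤ n′
  k≤n′ with suc κ ≤? n′
  ... | yes k≤n′ = k≤n′
  ... | no  k≰n′ = ⊥-elim (<⇒≱ (*-mono-< (≰⇒> k≰n′) (≰⇒> k≰n′)) (≤-trans k²≤m′ (≤-trans m′≤C2 (C2≤square n′))))
  choose-r : ∀ r → r ≡ n′ / suc κ → HardInstance 8 n′ m′
  choose-r zero     r≡ = ⊥-elim (<⇒≱ (m≥n⇒m/n>0 k≤n′) (≤-reflexive (sym r≡)))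
  choose-r (suc r') r≡ = construction-is-hard κ r' k²≤m′ m′< rk≤n′ n′< n′≤m′
    where
    rk≤n′ : suc r' * suc κ ≤ n′
    rk≤n′ = subst (λ r → r * suc κ ≤ n′) (sym r≡) (m/n*n≤m n′ (suc κ))
    n′< : n′ < suc (suc r') * suc κ
    n′< = subst (n′ <_) (cong (λ r → suc κ + r * suc κ) (sym r≡))
            (subst (_< suc κ + (n′ / suc κ) * suc κ) (sym (m≡m%n+[m/n]*n n′ (suc κ)))
              (+-monoˡ-< ((n′ / suc κ) * suc κ) (m%n<n n′ (suc κ))))

theorem4p7 : Σ ℕ λ c → (1 ≤ c) ×
    ((n′ m′ : ℕ) → 1 ≤ n′ → n′ ≤ m′ → m′ ≤ n′ C 2 →
    Σ ℕ λ n → Σ ℕ λ m →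
    (n′ ≤ c * n) × (n ≤ c * n′) × (m′ ≤ c * m) × (m ≤ c * m′) ×
    Σ (Vec (Arc n) m) λ arcs →
    Σ (List (Fin n)) λ o₀ →
    (o₀ ↭ allFin n) ×
    Injective _≡_ _≡_ (lookup arcs) ×
    ((k : ℕ) → k ≤ m → Acyclic (Edge arcs k)) ×
    ((os : Fin (suc m) → List (Fin n)) →
    os zero ≡ o₀ →
    ((i : Fin m) → LocalStep (lookup arcs i) (os (inject₁ i)) (os (suc i))) →
    ((i : Fin m) → Topological (Edge arcs (suc (toℕ i))) (os (suc i))) →
    (ks : Fin m → ℕ) →
    ((i : Fin m) → MovesIn (ks i) (os (inject₁ i)) (os (suc i))) →
    n ^ 2 * m ≤ (c * sum (tabulate ks)) ^ 2))
theorem4p7 = 8 , s≤s z≤n , hard-instance
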